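{- For every integer $a \geq 7$, \[\mathcal{G}_{\mathcal{R}}(3,a) = \begin{cases} a, & \text{if } a \equiv 0 \text{ or } 3 \pmod 4,\\ a-4, & \text{otherwise}. \end{cases}\]
   Context: A position is an unordered pair $(a,b)$ of nonnegative integers (pile sizes). $\mathcal{R}$-Wythoff: a move either removes a positive number of tokens from the larger pile (or from either pile if both piles have equal size), or removes the same positive number of tokens from both piles. $\mathcal{G}_{\mathcal{R}}$ is the Sprague-Grundy function of $\mathcal{R}$-Wythoff: $\mathcal{G}_{\mathcal{R}}(p)=\mathrm{mex}\{\mathcal{G}_{\mathcal{R}}(q): q \text{ reachable from } p \text{ in one move}\}$, where $\mathrm{mex}(S)$ is the least nonnegative integer not in $S$ and $\mathrm{mex}\{\}=0$. -}

module Defs where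

open import Data.Nat using (ℕ; zero; suc; _+_; _∸_; _⊓_; _⊔_)
open import Data.Nat.Properties using (_≟_)
open import Data.List using (List; []; _∷_; map; upTo; _++_; length)
open import Data.Bool using (Bool; true; false; if_then_else_)
open import Relation.Nullary.Decidable using (⌊_⌋)

elem : ℕ → List ℕ → Bool
elem n [] = false
elem n (m ∷ ms) = if ⌊ n ≟ m ⌋ then true else elem n ms

-- mex S = least nonnegative integer not in S (search from n, with fuel;
-- fuel length S + 1 always suffices)
mexFrom : ℕ → ℕ → List ℕ → ℕ
mexFrom zero    n s = n
mexFrom (suc f) n s = if elem n s then mexFrom f (suc n) s else n

mex : List ℕ → ℕ
mex s = mexFrom (suc (length s)) 0 s

-- For position {a,b}, let x = min, y = max.
-- Options: (x , j) for j < y   (remove tokens from the larger pile;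
--            when x = y this also covers removing from either pile),
--          (x ∸ k , y ∸ k) for 1 ≤ k ≤ x  (remove k from both piles).
-- Every option has strictly smaller total, so fuel a + b + 1 suffices.
GF : ℕ → ℕ → ℕ → ℕ
GF zero    a b = 0
GF (suc f) a b =
  mex (map (λ j → GF f (a ⊓ b) j) (upTo (a ⊔ b))
       ++ map (λ k → GF f ((a ⊓ b) ∸ suc k) ((a ⊔ b) ∸ suc k)) (upTo (a ⊓ b)))

GR : ℕ → ℕ → ℕ
GR a b = GF (suc (a + b)) a b

module Submission where

-- Every option of a position {x , y} of R-Wythoff has a
-- smaller pile no larger than min(x , y), so the strip of positions whose
-- smaller pile is at most 3 is closed under moves.  On that strip we write
-- down an explicit candidate table (indexed by the ordered position m ≤ M)
-- and check that it satisfies the mex recursion; by induction on the total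
-- number of tokens it then agrees with the Sprague–Grundy function GR.

open import Defs
open import Data.Nat using (ℕ; _≤_; _∸_; _%_)
open import Data.Sum using (_⊎_)
open import Data.Product using (_×_)
open import Relation.Binary.PropositionalEquality using (_≡_)

open import Data.Nat using (zero; suc; _+_; _<_; _⊓_; _⊔_; z≤n; s≤s; z<s; s<s; _≤?_)
open import Data.Nat.Properties
open import Data.Nat.DivMod using ([m+n]%n≡m%n)
open import Data.List using (List; []; _∷_; map; upTo; _++_; length)
open import Data.List.Properties using (length-++; length-map; length-upTo; map-cong-local)
open import Data.List.Relation.Unary.Any using (here; there)
open import Data.List.Relation.Unary.All.Properties using (applyUpTo⁺₁)
open import Data.List.Membership.Propositional using (_∈_; _∉_)
open import Data.List.Membership.Propositional.Properties
  using (∈-map⁺; ∈-map⁻; ∈-++⁺ˡ; ∈-++⁺ʳ; ∈-++⁻; ∈-upTo⁺; ∈-upTo⁻)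
open import Data.Sum using (inj₁; inj₂)
open import Data.Bool using (true; false)
open import Function using (_∘_)
open import Data.Product using (_,_; ∃-syntax; proj₁)
open import Data.Empty using (⊥; ⊥-elim)
open import Relation.Nullary using (yes; no)
open import Relation.Binary.PropositionalEquality
  using (refl; sym; trans; cong; cong₂; subst; _≢_; module ≡-Reasoning)

∈⇒elem : ∀ {n s} → n ∈ s → elem n s ≡ true
∈⇒elem {n} {m ∷ s} n∈ with n ≟ m | n∈
... | yes _   | _          = refl
... | no  n≢m | here n≡m   = ⊥-elim (n≢m n≡m)
... | no  _   | there n∈s  = ∈⇒elem n∈s

∉⇒elem : ∀ {n s} → n ∉ s → elem n s ≡ false
∉⇒elem {n} {[]}    _   = refl
∉⇒elem {n} {m ∷ s} n∉ with n ≟ m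
... | yes n≡m = ⊥-elim (n∉ (here n≡m))
... | no  _   = ∉⇒elem (n∉ ∘ there)

-- mex s ≡ t as soon as 0, …, t - 1 occur in s and t does not; the bound
-- t ≤ length s ensures that the fuel of `mex` is sufficient.
module _ (s : List ℕ) (t : ℕ) (below : ∀ i → i < t → i ∈ s) (t∉s : t ∉ s) where

  mexFrom-≡ : ∀ fuel n → n ≤ t → t < n + fuel → mexFrom fuel n s ≡ t
  mexFrom-≡ zero n n≤t t<n+0 = ⊥-elim (<⇒≱ (subst (t <_) (+-identityʳ n) t<n+0) n≤t)
  mexFrom-≡ (suc fuel) n n≤t t<n+fuel with m≤n⇒m<n∨m≡n n≤t
  ... | inj₁ n<t rewrite ∈⇒elem (below n n<t) =
    mexFrom-≡ fuel (suc n) n<t (subst (t <_) (+-suc n fuel) t<n+fuel)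
  ... | inj₂ refl rewrite ∉⇒elem t∉s = refl

  mex-≡ : t ≤ length s → mex s ≡ t
  mex-≡ t≤len = mexFrom-≡ (suc (length s)) 0 z≤n (s≤s t≤len)

-- By definition
-- GF (suc f) x y = mex (optionValues (GF f) (x ⊓ y) (x ⊔ y)).
optionValues : (ℕ → ℕ → ℕ) → ℕ → ℕ → List ℕ
optionValues g m M =
  map (g m) (upTo M) ++ map (λ k → g (m ∸ suc k) (M ∸ suc k)) (upTo m)

module OptionList {g : ℕ → ℕ → ℕ} {m M : ℕ} where

  row-option : ∀ {j} → j < M → g m j ∈ optionValues g m M
  row-option j<M = ∈-++⁺ˡ (∈-map⁺ (g m) (∈-upTo⁺ j<M))

  diagonal-option : ∀ {k} → k < m → g (m ∸ suc k) (M ∸ suc k) ∈ optionValues g m M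
  diagonal-option k<m = ∈-++⁺ʳ (map (g m) (upTo M)) (∈-map⁺ _ (∈-upTo⁺ k<m))

  ∉-optionValues : ∀ {t} → (∀ j → j < M → g m j ≢ t) →
    (∀ k → k < m → g (m ∸ suc k) (M ∸ suc k) ≢ t) → t ∉ optionValues g m M
  ∉-optionValues rows diagonals t∈ with ∈-++⁻ (map (g m) (upTo M)) t∈
  ... | inj₁ t∈rows with j , j∈ , t≡ ← ∈-map⁻ (g m) t∈rows = rows j (∈-upTo⁻ j∈) (sym t≡)
  ... | inj₂ t∈diag with k , k∈ , t≡ ← ∈-map⁻ _ t∈diag = diagonals k (∈-upTo⁻ k∈) (sym t≡)

  length-optionValues : length (optionValues g m M) ≡ M + m
  length-optionValues = begin
    length (optionValues g m M)
      ≡⟨ length-++ (map (g m) (upTo M)) ⟩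
    length (map (g m) (upTo M)) + length (map _ (upTo m))
      ≡⟨ cong₂ _+_ (length-map _ (upTo M)) (length-map _ (upTo m)) ⟩
    length (upTo M) + length (upTo m)
      ≡⟨ cong₂ _+_ (length-upTo M) (length-upTo m) ⟩
    M + m ∎
    where open ≡-Reasoning

  optionValues-cong : ∀ {h} → (∀ j → j < M → g m j ≡ h m j) →
    (∀ k → k < m → g (m ∸ suc k) (M ∸ suc k) ≡ h (m ∸ suc k) (M ∸ suc k)) →
    optionValues g m M ≡ optionValues h m M
  optionValues-cong rows diagonals =
    cong₂ _++_ (map-cong-local (applyUpTo⁺₁ _ M (rows _)))
               (map-cong-local (applyUpTo⁺₁ _ m (diagonals _)))

ordered : (ℕ → ℕ → ℕ) → ℕ → ℕ → ℕ
ordered v x y = v (x ⊓ y) (x ⊔ y)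

⊓+⊔≡+ : ∀ x y → (x ⊓ y) + (x ⊔ y) ≡ x + y
⊓+⊔≡+ x y with ≤-total x y
... | inj₁ x≤y rewrite m≤n⇒m⊓n≡m x≤y | m≤n⇒m⊔n≡n x≤y = refl
... | inj₂ y≤x rewrite m≥n⇒m⊓n≡n y≤x | m≥n⇒m⊔n≡m y≤x = +-comm y x

-- The strip is closed under moves and every move lowers the
-- total number of tokens, which bounds the fuel needed.
module _ (v : ℕ → ℕ → ℕ) (c : ℕ)
  (mex-rule : ∀ m M → m ≤ c → m ≤ M → mex (optionValues (ordered v) m M) ≡ v m M) where

  GF-agrees : ∀ fuel x y → x ⊓ y ≤ c → x + y < fuel → GF fuel x y ≡ ordered v x y
  GF-agrees (suc fuel) x y m≤c x+y<1+fuel = begin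
    mex (optionValues (GF fuel) m M)
      ≡⟨ cong mex (optionValues-cong {h = ordered v} rows diagonals) ⟩
    mex (optionValues (ordered v) m M)
      ≡⟨ mex-rule m M m≤c (m⊓n≤m⊔n x y) ⟩
    v m M ∎
    where
    open ≡-Reasoning
    m M : ℕ
    m = x ⊓ y
    M = x ⊔ y
    open OptionList {GF fuel} {m} {M}

    m+M≤fuel : m + M ≤ fuel
    m+M≤fuel = subst (_≤ fuel) (sym (⊓+⊔≡+ x y)) (≤-pred x+y<1+fuel)

    rows : ∀ j → j < M → GF fuel m j ≡ ordered v m j
    rows j j<M = GF-agrees fuel m j (≤-trans (m⊓n≤m m j) m≤c)
      (<-≤-trans (+-monoʳ-< m j<M) m+M≤fuel)

    diagonals : ∀ k → k < m →
      GF fuel (m ∸ suc k) (M ∸ suc k) ≡ ordered v (m ∸ suc k) (M ∸ suc k)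
    diagonals k k<m = GF-agrees fuel (m ∸ suc k) (M ∸ suc k)
      (≤-trans (m⊓n≤m _ _) (≤-trans (m∸n≤m m (suc k)) m≤c))
      (<-≤-trans (+-mono-<-≤ (∸-monoʳ-< {o = zero} z<s k<m) (m∸n≤m M (suc k))) m+M≤fuel)

  GR-agrees : ∀ x y → x ⊓ y ≤ c → GR x y ≡ ordered v x y
  GR-agrees x y x⊓y≤c = GF-agrees (suc (x + y)) x y x⊓y≤c ≤-refl

swap₂ : ℕ → ℕ
swap₂ 0 = 2
swap₂ 1 = 3
swap₂ 2 = 0
swap₂ 3 = 1
swap₂ (suc (suc (suc (suc n)))) = 4 + swap₂ n

swap₂-involutive : ∀ n → swap₂ (swap₂ n) ≡ n
swap₂-involutive 0 = refl
swap₂-involutive 1 = refl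
swap₂-involutive 2 = refl
swap₂-involutive 3 = refl
swap₂-involutive (suc (suc (suc (suc n)))) = cong (4 +_) (swap₂-involutive n)

swap₂-injective : ∀ {k n} → swap₂ k ≡ swap₂ n → k ≡ n
swap₂-injective {k} {n} e = begin
  k                  ≡⟨ sym (swap₂-involutive k) ⟩
  swap₂ (swap₂ k)    ≡⟨ cong swap₂ e ⟩
  swap₂ (swap₂ n)    ≡⟨ swap₂-involutive n ⟩
  n                  ∎
  where open ≡-Reasoning

High Low : ℕ → Set
High a = a % 4 ≡ 0 ⊎ a % 4 ≡ 3
Low  a = a % 4 ≡ 1 ⊎ a % 4 ≡ 2

High-Low-disjoint : ∀ {r : ℕ} → (r ≡ 0 ⊎ r ≡ 3) → (r ≡ 1 ⊎ r ≡ 2) → ⊥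
High-Low-disjoint (inj₁ refl) (inj₁ ())
High-Low-disjoint (inj₁ refl) (inj₂ ())
High-Low-disjoint (inj₂ refl) (inj₁ ())
High-Low-disjoint (inj₂ refl) (inj₂ ())

residue-shift : ∀ {a r r′} → a % 4 ≡ r ⊎ a % 4 ≡ r′ → (4 + a) % 4 ≡ r ⊎ (4 + a) % 4 ≡ r′
residue-shift {a} = Data.Sum.map (trans period) (trans period)
  where
  period : (4 + a) % 4 ≡ a % 4
  period = trans (cong (_% 4) (+-comm 4 a)) ([m+n]%n≡m%n a 4)

swap₂-by-residue : ∀ n → (swap₂ n ≡ 2 + n × High (7 + n)) ⊎ (2 + swap₂ n ≡ n × Low (7 + n))
swap₂-by-residue 0 = inj₁ (refl , inj₂ refl)
swap₂-by-residue 1 = inj₁ (refl , inj₁ refl)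
swap₂-by-residue 2 = inj₂ (refl , inj₁ refl)
swap₂-by-residue 3 = inj₂ (refl , inj₂ refl)
swap₂-by-residue (suc (suc (suc (suc n)))) with swap₂-by-residue n
... | inj₁ (up , high)  = inj₁ (cong (4 +_) up , residue-shift {7 + n} high)
... | inj₂ (down , low) = inj₂ (cong (4 +_) down , residue-shift {7 + n} low)

swap₂-near : ∀ n → swap₂ n ≡ 2 + n ⊎ 2 + swap₂ n ≡ n
swap₂-near n = Data.Sum.map proj₁ proj₁ (swap₂-by-residue n)

swap₂-≤ : ∀ n → swap₂ n ≤ 2 + n
swap₂-≤ n with swap₂-near n
... | inj₁ up   = ≤-reflexive up
... | inj₂ down = ≤-trans (m≤n+m (swap₂ n) 2) (≤-trans (≤-reflexive down) (m≤n+m n 2))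

within-2 : ∀ {n x} → n ≤ x → x ≤ 2 + n → x ≡ n ⊎ x ≡ 1 + n ⊎ x ≡ 2 + n
within-2 {zero} {0} _ _ = inj₁ refl
within-2 {zero} {1} _ _ = inj₂ (inj₁ refl)
within-2 {zero} {2} _ _ = inj₂ (inj₂ refl)
within-2 {zero} {suc (suc (suc x))} _ (s≤s (s≤s ()))
within-2 {suc n} {suc x} (s≤s n≤x) (s≤s x≤2+n) =
  Data.Sum.map (cong suc) (Data.Sum.map (cong suc) (cong suc)) (within-2 n≤x x≤2+n)

-- The final clause covers positions that never occur.
candidate : ℕ → ℕ → ℕ
candidate 0 M = M
candidate 1 1 = 2
candidate 1 2 = 0
candidate 2 2 = 1
candidate 1 (suc (suc (suc k))) = 3 + k
candidate 2 (suc (suc (suc k))) = 3 + k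
candidate 3 3 = 4
candidate 3 4 = 2
candidate 3 5 = 0
candidate 3 6 = 1
candidate 3 (suc (suc (suc (suc (suc (suc (suc n))))))) = 5 + swap₂ n
candidate _ _ = 0

Options : ℕ → ℕ → List ℕ
Options = optionValues (ordered candidate)

candidate-low-bound : ∀ m M → m ≤ 2 → candidate m M ≤ M ⊔ 2
candidate-low-bound 0 M _ = m≤m⊔n M 2
candidate-low-bound 1 0 _ = z≤n
candidate-low-bound 1 1 _ = ≤-refl
candidate-low-bound 1 2 _ = z≤n
candidate-low-bound 1 (suc (suc (suc k))) _ = m≤m⊔n (3 + k) 2
candidate-low-bound 2 0 _ = z≤n
candidate-low-bound 2 1 _ = z≤n
candidate-low-bound 2 2 _ = s≤s z≤n
candidate-low-bound 2 (suc (suc (suc k))) _ = m≤m⊔n (3 + k) 2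
candidate-low-bound (suc (suc (suc _))) _ (s≤s (s≤s ()))

ordered-low-bound : ∀ {x y t} → x ⊓ y ≤ 2 → x < t → y < t → 2 < t → ordered candidate x y < t
ordered-low-bound {x} {y} x⊓y≤2 x<t y<t 2<t =
  ≤-<-trans (candidate-low-bound (x ⊓ y) (x ⊔ y) x⊓y≤2) (⊔-lub (⊔-lub x<t y<t) 2<t)

low-row-large : ∀ m p → m ≤ 2 → ordered candidate m (3 + p) ≡ 3 + p
low-row-large 0 p _ = refl
low-row-large 1 p _ = refl
low-row-large 2 p _ = refl
low-row-large (suc (suc (suc _))) p (s≤s (s≤s ()))

low-row-corner : ∀ m i → m ≤ 2 → i < 3 → ∃[ j ] j < 3 × ordered candidate m j ≡ i
low-row-corner 0 i _ i<3 = i , i<3 , refl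
low-row-corner 1 0 _ _ = 2 , s<s (s<s z<s) , refl
low-row-corner 1 1 _ _ = 0 , z<s , refl
low-row-corner 1 2 _ _ = 1 , s<s z<s , refl
low-row-corner 2 0 _ _ = 1 , s<s z<s , refl
low-row-corner 2 1 _ _ = 2 , s<s (s<s z<s) , refl
low-row-corner 2 2 _ _ = 0 , z<s , refl
low-row-corner 1 (suc (suc (suc _))) _ (s≤s (s≤s (s≤s ())))
low-row-corner 2 (suc (suc (suc _))) _ (s≤s (s≤s (s≤s ())))
low-row-corner (suc (suc (suc _))) _ (s≤s (s≤s ())) _

-- The mex recursion in rows 0–2 beyond the corner: every value below M is
-- taken by a move on the larger pile, and no option reaches M.
low-rows : ∀ m k → m ≤ 2 → mex (Options m (3 + k)) ≡ 3 + k
low-rows m k m≤2 = mex-≡ (Options m (3 + k)) (3 + k) present absent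
  (subst (3 + k ≤_) (sym length-optionValues) (m≤m+n (3 + k) m))
  where
  open OptionList {ordered candidate} {m} {3 + k}

  m<3+k : m < 3 + k
  m<3+k = s≤s (≤-trans m≤2 (m≤m+n 2 k))

  2<3+k : 2 < 3 + k
  2<3+k = s≤s (m≤m+n 2 k)

  corner : ∀ i → i < 3 → i ∈ Options m (3 + k)
  corner i i<3 with j , j<3 , e ← low-row-corner m i m≤2 i<3 =
    subst (_∈ Options m (3 + k)) e (row-option (≤-trans j<3 (m≤m+n 3 k)))

  present : ∀ i → i < 3 + k → i ∈ Options m (3 + k)
  present 0 _ = corner 0 z<s
  present 1 _ = corner 1 (s<s z<s)
  present 2 _ = corner 2 (s<s (s<s z<s))
  present (suc (suc (suc p))) i<3+k =
    subst (_∈ Options m (3 + k)) (low-row-large m p m≤2) (row-option i<3+k)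

  absent : 3 + k ∉ Options m (3 + k)
  absent = ∉-optionValues
    (λ j j<3+k e → <-irrefl e
      (ordered-low-bound (≤-trans (m⊓n≤m m j) m≤2) m<3+k j<3+k 2<3+k))
    (λ d d<m e → <-irrefl e
      (ordered-low-bound (≤-trans (m⊓n≤m _ _) (≤-trans (m∸n≤m m (suc d)) m≤2))
        (≤-<-trans (m∸n≤m m (suc d)) m<3+k) (s≤s (m∸n≤m (2 + k) d)) 2<3+k))

-- Writing t = 5 + swap₂ n, the
-- options of (3 , 7 + n) have values 3, 3, 3, 4, 2, 0, 1 (moves to M < 7),
-- 5 + swap₂ k for k < n (moves to M = 7 + k) and 6 + n, 5 + n, 4 + n
-- (diagonal moves).  Since swap₂ is a bijection moving by two, these cover
-- every value below t and miss t, which is 7 + n or 3 + n.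
row3 : ∀ n → mex (Options 3 (7 + n)) ≡ 5 + swap₂ n
row3 n = mex-≡ (Options 3 (7 + n)) (5 + swap₂ n) present absent
  (subst (5 + swap₂ n ≤_) (sym length-optionValues)
    (≤-trans (+-monoʳ-≤ 5 (swap₂-≤ n)) (m≤m+n (7 + n) 3)))
  where
  open OptionList {ordered candidate} {3} {7 + n}

  diagonal-values : ∀ x → n ≤ x → x ≤ 2 + n → 4 + x ∈ Options 3 (7 + n)
  diagonal-values x n≤x x≤2+n with within-2 n≤x x≤2+n
  ... | inj₁ refl        = diagonal-option {k = 2} (s<s (s<s z<s))
  ... | inj₂ (inj₁ refl) = diagonal-option {k = 1} (s<s z<s)
  ... | inj₂ (inj₂ refl) = diagonal-option {k = 0} z<s

  preimage< : ∀ p → p < swap₂ n → 2 + p ≤ n → swap₂ p < n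
  preimage< p p<σn 2+p≤n = ≤∧≢⇒< (≤-trans (swap₂-≤ p) 2+p≤n) σp≢n
    where
    σp≢n : swap₂ p ≢ n
    σp≢n σp≡n = <-irrefl (trans (sym (swap₂-involutive p)) (cong swap₂ σp≡n)) p<σn

  -- a value 5 + p below t is a diagonal value when p + 1 ≥ n, and
  -- otherwise the value of the move to M = 7 + swap₂ p
  large-values : ∀ p → p < swap₂ n → 5 + p ∈ Options 3 (7 + n)
  large-values p p<σn with n ≤? suc p
  ... | yes n≤1+p = diagonal-values (suc p) n≤1+p (≤-trans p<σn (swap₂-≤ n))
  ... | no n≰1+p =
    subst (_∈ Options 3 (7 + n)) (cong (5 +_) (swap₂-involutive p))
      (row-option (+-monoʳ-< 7 (preimage< p p<σn (≰⇒> n≰1+p))))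

  -- the values 0, …, 4 come from moves to M ≤ 6 (each j < 7 + n is proved
  -- as j + 1 ≤ (j + 1) + d)
  present : ∀ i → i < 5 + swap₂ n → i ∈ Options 3 (7 + n)
  present 0 _ = row-option {j = 5} (m≤m+n 6 (1 + n))
  present 1 _ = row-option {j = 6} (m≤m+n 7 n)
  present 2 _ = row-option {j = 4} (m≤m+n 5 (2 + n))
  present 3 _ = row-option {j = 0} (m≤m+n 1 (6 + n))
  present 4 _ = row-option {j = 3} (m≤m+n 4 (3 + n))
  present (suc (suc (suc (suc (suc p))))) i<t =
    large-values p (+-cancelˡ-< 5 p (swap₂ n) i<t)

  misses : ∀ a → a ≢ 7 → a ≢ 3 → a + n ≢ 5 + swap₂ n
  misses a a≢7 a≢3 e with swap₂-near n
  ... | inj₁ up   = a≢7 (+-cancelʳ-≡ n a 7 (trans e (cong (5 +_) up)))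
  ... | inj₂ down = a≢3 (+-cancelʳ-≡ n a 3 (trans e (cong (3 +_) down)))

  rows : ∀ j → j < 7 + n → ordered candidate 3 j ≢ 5 + swap₂ n
  rows 0 _ ()
  rows 1 _ ()
  rows 2 _ ()
  rows 3 _ ()
  rows 4 _ ()
  rows 5 _ ()
  rows 6 _ ()
  rows (suc (suc (suc (suc (suc (suc (suc k))))))) j<7+n e =
    <-irrefl (swap₂-injective (+-cancelˡ-≡ 5 _ _ e)) (+-cancelˡ-< 7 k n j<7+n)

  diagonals : ∀ k → k < 3 → ordered candidate (3 ∸ suc k) ((7 + n) ∸ suc k) ≢ 5 + swap₂ n
  diagonals 0 _ = misses 6 (λ ()) (λ ())
  diagonals 1 _ = misses 5 (λ ()) (λ ())
  diagonals 2 _ = misses 4 (λ ()) (λ ())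
  diagonals (suc (suc (suc _))) (s≤s (s≤s (s≤s ())))

  absent : 5 + swap₂ n ∉ Options 3 (7 + n)
  absent = ∉-optionValues rows diagonals

candidate-mex : ∀ m M → m ≤ 3 → m ≤ M → mex (Options m M) ≡ candidate m M
candidate-mex 0 0 _ _ = refl
candidate-mex 0 1 _ _ = refl
candidate-mex 0 2 _ _ = refl
candidate-mex 1 1 _ _ = refl
candidate-mex 1 2 _ _ = refl
candidate-mex 2 2 _ _ = refl
candidate-mex 3 3 _ _ = refl
candidate-mex 3 4 _ _ = refl
candidate-mex 3 5 _ _ = refl
candidate-mex 3 6 _ _ = refl
candidate-mex 0 (suc (suc (suc k))) _ _ = low-rows 0 k z≤n
candidate-mex 1 (suc (suc (suc k))) _ _ = low-rows 1 k (s≤s z≤n)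
candidate-mex 2 (suc (suc (suc k))) _ _ = low-rows 2 k (s≤s (s≤s z≤n))
candidate-mex 3 (suc (suc (suc (suc (suc (suc (suc n))))))) _ _ = row3 n
candidate-mex 1 0 _ ()
candidate-mex 2 0 _ ()
candidate-mex 2 1 _ (s≤s ())
candidate-mex 3 0 _ ()
candidate-mex 3 1 _ (s≤s ())
candidate-mex 3 2 _ (s≤s (s≤s ()))
candidate-mex (suc (suc (suc (suc _)))) _ (s≤s (s≤s (s≤s ()))) _

GR-row3 : ∀ n → GR 3 (7 + n) ≡ 5 + swap₂ n
GR-row3 n = GR-agrees candidate 3 candidate-mex 3 (7 + n) ≤-refl

Row3Claim : ℕ → Set
Row3Claim a = (High a → GR 3 a ≡ a) × (Low a → GR 3 a ≡ a ∸ 4)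

-- For a = 7 + n, GR 3 a = 5 + swap₂ n is a or a - 4 = 3 + n according to
-- the residue of a modulo 4.  The case split is taken as an argument: a
-- `with` on it would make Agda normalise GR 3 (7 + n) in the goal.
row3-claim : ∀ n → (swap₂ n ≡ 2 + n × High (7 + n)) ⊎ (2 + swap₂ n ≡ n × Low (7 + n)) →
  Row3Claim (7 + n)
row3-claim n (inj₁ (up , high)) =
  (λ _ → trans (GR-row3 n) (cong (5 +_) up)) , (λ low → ⊥-elim (High-Low-disjoint high low))
row3-claim n (inj₂ (down , low)) =
  (λ high → ⊥-elim (High-Low-disjoint high low)) , (λ _ → trans (GR-row3 n) (cong (3 +_) down))

lemma2p12 : (a : ℕ) → 7 ≤ a →
    ((a % 4 ≡ 0 ⊎ a % 4 ≡ 3) → GR 3 a ≡ a) ×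
    ((a % 4 ≡ 1 ⊎ a % 4 ≡ 2) → GR 3 a ≡ a ∸ 4)
lemma2p12 a 7≤a =
  let n , 7+n≡a = m≤n⇒∃[o]m+o≡n 7≤a in subst Row3Claim 7+n≡a (row3-claim n (swap₂-by-residue n))
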